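{- Let $k \geq 0$, $n = 2^k$, and let $t$ be an integer with $2^k \leq t < 2^{k+1}$. Then the polynomial $$\mathcal{K}_n^{(t)}(x) = \sum_{j=0}^{n} (-2)^j \binom{t-j}{n-j}\binom{x}{j} \in \mathbf{Q}[x]$$ is Eisenstein at $p=2$ (its $2$-adic Newton polygon is a single segment containing no lattice points other than its endpoints) and hence is irreducible over $\mathbf{Q}$.
   Context: Here $\binom{x}{j} = \frac{x(x-1)\cdots(x-j+1)}{j!}$. For $f(x)=\sum_{j=0}^n a_jx^j\in\mathbf{Q}[x]$ of degree $n$, the $2$-adic Newton polygon is the lower convex hull of the points $(n-j, v_2(a_j))$, $a_j\neq 0$. -}

module Defs where

open import Data.Nat as ℕ using (ℕ; zero; suc; _∸_; _!; _%_)
open import Data.Nat.Properties using (_!≢0)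
open import Data.Nat.Combinatorics using (_C_)
open import Data.Integer as ℤ using (ℤ; +_)
open import Data.Integer.Divisibility as ℤDiv using ()
open import Data.Rational as ℚ using (ℚ; 0ℚ; 1ℚ; _+_; _*_; -_; ↥_; ↧ₙ_)
open import Data.List using (List; []; _∷_; map)
open import Data.Product using (_×_; Σ)
open import Data.Sum using (_⊎_)
open import Relation.Nullary using (¬_)
open import Relation.Binary.PropositionalEquality using (_≡_; _≢_)

-- Polynomials over ℚ as coefficient lists (constant term first).

Poly : Set
Poly = List ℚ

coeff : Poly → ℕ → ℚ
coeff []       _       = 0ℚ
coeff (a ∷ f)  zero    = a
coeff (a ∷ f)  (suc j) = coeff f j

infixl 6 _+ₚ_
_+ₚ_ : Poly → Poly → Poly
[]      +ₚ g       = g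
(a ∷ f) +ₚ []      = a ∷ f
(a ∷ f) +ₚ (b ∷ g) = (a + b) ∷ (f +ₚ g)

scale : ℚ → Poly → Poly
scale c f = map (c *_) f

infixl 7 _*ₚ_
_*ₚ_ : Poly → Poly → Poly
[]      *ₚ g = []
(a ∷ f) *ₚ g = scale a g +ₚ (0ℚ ∷ (f *ₚ g))

-- polynomial equality (coefficientwise, so trailing zeros are irrelevant)
_≈ₚ_ : Poly → Poly → Set
f ≈ₚ g = ∀ j → coeff f j ≡ coeff g j

NonConstant : Poly → Set
NonConstant f = Σ ℕ (λ j → coeff f (suc j) ≢ 0ℚ)

Irreducible : Poly → Set
Irreducible f = NonConstant f ×
  (∀ g h → f ≈ₚ (g *ₚ h) → ¬ NonConstant g ⊎ ¬ NonConstant h)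

ℕ→ℚ : ℕ → ℚ
ℕ→ℚ n = (+ n) ℚ./ 1

ℤ→ℚ : ℤ → ℚ
ℤ→ℚ z = z ℚ./ 1

falling : ℕ → Poly
falling zero    = 1ℚ ∷ []
falling (suc j) = falling j *ₚ ((- ℕ→ℚ j) ∷ 1ℚ ∷ [])

binomPoly : ℕ → Poly
binomPoly j = scale (ℚ._/_ (+ 1) (j !) {{j !≢0}}) (falling j)

Kpoly : ℕ → ℕ → Poly
Kpoly n t = go n
  where
  term : ℕ → Poly
  term j = scale (ℤ→ℚ ((ℤ.- (+ 2)) ℤ.^ j) * ℕ→ℚ ((t ∸ j) C (n ∸ j))) (binomPoly j)
  go : ℕ → Poly
  go zero    = term zero
  go (suc j) = go j +ₚ term (suc j)

-- v₂ on ℕ with fuel (fuel = n suffices for n ≥ 1); v2ℕ 0 = 0 (unused)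
v2fuel : ℕ → ℕ → ℕ
v2fuel zero    _ = 0
v2fuel (suc f) zero = 0
v2fuel (suc f) (suc m) with suc m % 2
... | zero  = suc (v2fuel f (suc m ℕ./ 2))
... | suc _ = 0

v2ℕ : ℕ → ℕ
v2ℕ n = v2fuel n n

v2 : ℚ → ℤ
v2 q = (+ v2ℕ ℤ.∣ ↥ q ∣) ℤ.- (+ v2ℕ (↧ₙ q))

-- "Eisenstein at 2" for a polynomial f of degree n ≥ 1: its 2-adic
-- Newton polygon (lower convex hull of the points (n-j, v₂ a_j), a_j ≠ 0)
-- is the single segment from (0, v₂ a_n) to (n, v₂ a_0), containing no
-- lattice points other than its endpoints.

Eisenstein2 : ℕ → Poly → Set
Eisenstein2 n f =
  (coeff f n ≢ 0ℚ) × (∀ j → n ℕ.< j → coeff f j ≡ 0ℚ) ×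
  (coeff f 0 ≢ 0ℚ) ×
  -- every point (n-j, v₂ a_j) lies on or above the segment
  -- (the hull is this single segment)
  (∀ j → j ℕ.≤ n → coeff f j ≢ 0ℚ →
     (+ j) ℤ.* vn ℤ.+ (+ (n ∸ j)) ℤ.* v0 ℤ.≤ (+ n) ℤ.* v2 (coeff f j)) ×
  -- no lattice point strictly inside the segment: at abscissa i (0<i<n)
  -- the segment has height vn + i (v0 - vn)/n
  (∀ i → 0 ℕ.< i → i ℕ.< n → ¬ ((+ n) ℤDiv.∣ ((+ i) ℤ.* (v0 ℤ.- vn))))
  where
  vn = v2 (coeff f n)
  v0 = v2 (coeff f 0)

{-# OPTIONS --safe #-}
-- The term (-2)^j C(t-j, n-j) binom(x, j) of K has coefficients of 2-adic valuation at least
-- j - v₂(j!) ≥ 1 for j ≥ 1, and no constant term. So the constant term of K is C(t, n), odd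
-- because adding n = 2^k and t - n < 2^k in base 2 produces no carry (Kummer), while the leading
-- coefficient (-2)^n/n! has valuation n - v₂((2^k)!) = 1: the reversed polynomial xⁿ K(1/x) is
-- Eisenstein at 2, and the Newton polygon of K is the segment from (0, 1) to (n, 0).
-- For irreducibility, factor K = g h and take in each factor the last coefficient of minimal
-- valuation, μ resp. ν. The matching coefficient of K has valuation μ + ν, which forces both
-- to sit in degree 0 with μ + ν = 0; the leading coefficients of g and h then have valuations
-- above μ and ν, so that of K would have valuation at least 2.
module Submission where

open import Data.Nat using (ℕ; zero; suc; _+_; _*_; _∸_; _^_; _!; _≤_; _<_; z≤n; s≤s; NonZero)
open import Data.Nat.Properties
open import Data.Nat.DivMod using (_%_; _/_; m*n%n≡0; m*n/n≡m; m/n*n≡m; [m+kn]%n≡m%n)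
open import Data.Nat.Combinatorics using (_C_; nCk≡n!/k![n-k]!; k![n∸k]!∣n!)
open import Data.Nat.Divisibility using (_∣_; divides; ∣-trans; ∣⇒≤)
open import Data.Nat.Induction using (<-rec)
open import Data.Product using (∃-syntax; ∃₂; _×_; _,_; proj₁; proj₂)
open import Data.Empty using (⊥; ⊥-elim)
open import Function using (_∘_)
open import Relation.Binary.PropositionalEquality
open import Relation.Nullary using (¬_; Dec; yes; no)
open import Relation.Binary.Definitions using (tri<; tri≈; tri>)
open import Defs
open import Data.Nat.Solver using (module +-*-Solver)
import Algebra.Properties.CommutativeSemigroup as CommSemigroupProperties
module +-CS = CommSemigroupProperties +-commutativeSemigroup
module *-CS = CommSemigroupProperties *-commutativeSemigroup

-- 2-adic valuation of natural numbers

Odd : ℕ → Set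
Odd n = ∃[ m ] n ≡ suc (2 * m)

odd>0 : ∀ {n} → Odd n → 0 < n
odd>0 (m , refl) = s≤s z≤n

*-pos : ∀ {x y} → 0 < x → 0 < y → 0 < x * y
*-pos {suc x} {suc y} _ _ = s≤s z≤n

m*n>0⇒m>0 : ∀ {m n} → 0 < m * n → 0 < m
m*n>0⇒m>0 {suc m} _ = s≤s z≤n

data EvenOdd : ℕ → Set where
  even : ∀ m → EvenOdd (2 * m)
  odd  : ∀ m → EvenOdd (suc (2 * m))

evenOdd : ∀ n → EvenOdd n
evenOdd zero = even 0
evenOdd (suc n) with evenOdd n
... | even m = odd m
... | odd m = subst EvenOdd (*-suc 2 m) (even (suc m))

2*n%2≡0 : ∀ n → 2 * n % 2 ≡ 0
2*n%2≡0 n = trans (cong (_% 2) (*-comm 2 n)) (m*n%n≡0 n 2)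

2*n/2≡n : ∀ n → 2 * n / 2 ≡ n
2*n/2≡n n = trans (cong (_/ 2) (*-comm 2 n)) (m*n/n≡m n 2)

[1+2*n]%2≡1 : ∀ n → suc (2 * n) % 2 ≡ 1
[1+2*n]%2≡1 n = trans (cong (λ x → suc x % 2) (*-comm 2 n)) ([m+kn]%n≡m%n 1 n 2)

v2fuel-odd : ∀ f m → v2fuel (suc f) (suc (2 * m)) ≡ 0
v2fuel-odd f m rewrite [1+2*n]%2≡1 m = refl

v2fuel-double : ∀ f n → v2fuel (suc f) (2 * suc n) ≡ suc (v2fuel f (suc n))
v2fuel-double f n rewrite 2*n%2≡0 (suc n) | 2*n/2≡n (suc n) = refl

n<2*n : ∀ n → 0 < n → n < 2 * n
n<2*n n@(suc _) _ = subst (n <_) (*-comm n 2) (m<m*n n 2 ≤-refl)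

v2fuel-2^*odd : ∀ a {f o} → Odd o → 2 ^ a * o ≤ f → v2fuel f (2 ^ a * o) ≡ a
v2fuel-2^*odd zero {suc f} (m , refl) _ =
  trans (cong (v2fuel (suc f)) (*-identityˡ (suc (2 * m)))) (v2fuel-odd f m)
v2fuel-2^*odd (suc a) {f} {o} o-odd le rewrite *-assoc 2 (2 ^ a) o =
  double (2 ^ a * o) (*-pos (m^n>0 2 a) (odd>0 o-odd)) (v2fuel-2^*odd a o-odd) le
  where
  double : ∀ {f} x → 0 < x → (∀ {g} → x ≤ g → v2fuel g x ≡ a) → 2 * x ≤ f → v2fuel f (2 * x) ≡ suc a
  double {suc f} (suc n) _ ih le =
    trans (v2fuel-double f n) (cong suc (ih (≤-pred (<-≤-trans (n<2*n (suc n) (s≤s z≤n)) le))))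

v2ℕ-2^*odd : ∀ a {o} → Odd o → v2ℕ (2 ^ a * o) ≡ a
v2ℕ-2^*odd a o-odd = v2fuel-2^*odd a o-odd ≤-refl

1-odd : Odd 1
1-odd = 0 , refl

v2ℕ-2^ : ∀ a → v2ℕ (2 ^ a) ≡ a
v2ℕ-2^ a = subst (λ n → v2ℕ n ≡ a) (*-identityʳ (2 ^ a)) (v2ℕ-2^*odd a 1-odd)

v2ℕ-odd : ∀ {o} → Odd o → v2ℕ o ≡ 0
v2ℕ-odd {o} o-odd = subst (λ n → v2ℕ n ≡ 0) (+-identityʳ o) (v2ℕ-2^*odd 0 o-odd)

odd-decomposition : ∀ n → 0 < n → ∃₂ λ a o → Odd o × n ≡ 2 ^ a * o
odd-decomposition = <-rec _ step
  where
  step : ∀ n → (∀ {m} → m < n → 0 < m → ∃₂ λ a o → Odd o × m ≡ 2 ^ a * o) →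
         0 < n → ∃₂ λ a o → Odd o × n ≡ 2 ^ a * o
  step n rec n>0 with evenOdd n
  step _ rec n>0 | odd m = 0 , suc (2 * m) , (m , refl) , sym (*-identityˡ (suc (2 * m)))
  step _ rec () | even zero
  step _ rec n>0 | even (suc m) with rec (n<2*n (suc m) (s≤s z≤n)) (s≤s z≤n)
  ... | a , o , o-odd , m≡2^a*o = suc a , o , o-odd , trans (cong (2 *_) m≡2^a*o) (sym (*-assoc 2 (2 ^ a) o))

v2ℕ-decomposition : ∀ n → 0 < n → ∃[ o ] Odd o × n ≡ 2 ^ v2ℕ n * o
v2ℕ-decomposition n n>0 with odd-decomposition n n>0
... | a , o , o-odd , n≡2^a*o =
  o , o-odd , trans n≡2^a*o (cong (λ b → 2 ^ b * o) (sym (trans (cong v2ℕ n≡2^a*o) (v2ℕ-2^*odd a o-odd))))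

odd-* : ∀ {x y} → Odd x → Odd y → Odd (x * y)
odd-* (m , refl) (n , refl) = m + n + 2 * (m * n) ,
  solve 2 (λ m n → (con 1 :+ con 2 :* m) :* (con 1 :+ con 2 :* n) := con 1 :+ con 2 :* (m :+ n :+ con 2 :* (m :* n))) refl m n
  where open +-*-Solver

v2ℕ-* : ∀ {x y} → 0 < x → 0 < y → v2ℕ (x * y) ≡ v2ℕ x + v2ℕ y
v2ℕ-* {x} {y} x>0 y>0 with v2ℕ-decomposition x x>0 | v2ℕ-decomposition y y>0
... | o , o-odd , x≡ | o′ , o′-odd , y≡ = begin
  v2ℕ (x * y)                                ≡⟨ cong v2ℕ (cong₂ _*_ x≡ y≡) ⟩
  v2ℕ ((2 ^ v2ℕ x * o) * (2 ^ v2ℕ y * o′))   ≡⟨ cong v2ℕ (*-CS.interchange (2 ^ v2ℕ x) o (2 ^ v2ℕ y) o′) ⟩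
  v2ℕ ((2 ^ v2ℕ x * 2 ^ v2ℕ y) * (o * o′))   ≡⟨ cong (λ p → v2ℕ (p * (o * o′))) (^-distribˡ-+-* 2 (v2ℕ x) (v2ℕ y)) ⟨
  v2ℕ (2 ^ (v2ℕ x + v2ℕ y) * (o * o′))       ≡⟨ v2ℕ-2^*odd (v2ℕ x + v2ℕ y) (odd-* o-odd o′-odd) ⟩
  v2ℕ x + v2ℕ y                              ∎
  where open ≡-Reasoning

2^v2ℕ∣n : ∀ {n} → 0 < n → 2 ^ v2ℕ n ∣ n
2^v2ℕ∣n {n} n>0 with v2ℕ-decomposition n n>0
... | o , _ , n≡ = divides o (trans n≡ (*-comm (2 ^ v2ℕ n) o))

2^m∣2^n : ∀ {m n} → m ≤ n → 2 ^ m ∣ 2 ^ n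
2^m∣2^n {m} {n} m≤n = divides (2 ^ (n ∸ m))
  (trans (cong (2 ^_) (sym (m∸n+n≡m m≤n))) (^-distribˡ-+-* 2 (n ∸ m) m))

2^m∣n⇒m≤v2ℕn : ∀ m n → 0 < n → 2 ^ m ∣ n → m ≤ v2ℕ n
2^m∣n⇒m≤v2ℕn m _ () (divides zero refl)
2^m∣n⇒m≤v2ℕn m n n>0 (divides q@(suc _) n≡q*2^m) = subst (m ≤_) (sym v2ℕn≡) (m≤n+m m (v2ℕ q))
  where
  v2ℕn≡ : v2ℕ n ≡ v2ℕ q + m
  v2ℕn≡ = trans (cong v2ℕ n≡q*2^m) (trans (v2ℕ-* (s≤s z≤n) (m^n>0 2 m)) (cong (v2ℕ q +_) (v2ℕ-2^ m)))

v2ℕ-odd* : ∀ {o x} → Odd o → 0 < x → v2ℕ (o * x) ≡ v2ℕ x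
v2ℕ-odd* {o} {x} o-odd x>0 = trans (v2ℕ-* (odd>0 o-odd) x>0) (cong (_+ v2ℕ x) (v2ℕ-odd o-odd))

v2ℕ-2* : ∀ {x} → 0 < x → v2ℕ (2 * x) ≡ suc (v2ℕ x)
v2ℕ-2* x>0 = v2ℕ-* {2} (s≤s z≤n) x>0

-- Factorials and binomial coefficients

v2ℕ-[1+2m]! : ∀ m → v2ℕ (suc (2 * m) !) ≡ v2ℕ ((2 * m) !)
v2ℕ-[1+2m]! m = v2ℕ-odd* (m , refl) (1≤n! (2 * m))

v2ℕ-[2m]! : ∀ m → v2ℕ ((2 * m) !) ≡ m + v2ℕ (m !)
v2ℕ-[2m]! zero = refl
v2ℕ-[2m]! (suc m) = begin
  v2ℕ ((2 * suc m) !)                             ≡⟨ cong v2ℕ [2+2m]! ⟩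
  v2ℕ (2 * suc m * (suc (2 * m) !))               ≡⟨ v2ℕ-* (s≤s z≤n) (1≤n! (suc (2 * m))) ⟩
  v2ℕ (2 * suc m) + v2ℕ (suc (2 * m) !)           ≡⟨ cong₂ _+_ (v2ℕ-2* (s≤s z≤n)) (v2ℕ-[1+2m]! m) ⟩
  suc (v2ℕ (suc m)) + v2ℕ ((2 * m) !)             ≡⟨ cong (suc (v2ℕ (suc m)) +_) (v2ℕ-[2m]! m) ⟩
  suc (v2ℕ (suc m)) + (m + v2ℕ (m !))             ≡⟨ cong suc (+-CS.x∙yz≈y∙xz (v2ℕ (suc m)) m (v2ℕ (m !))) ⟩
  suc m + (v2ℕ (suc m) + v2ℕ (m !))               ≡⟨ cong (suc m +_) (v2ℕ-* (s≤s z≤n) (1≤n! m)) ⟨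
  suc m + v2ℕ (suc m !)                           ∎
  where
  open ≡-Reasoning
  [2+2m]! : (2 * suc m) ! ≡ 2 * suc m * (suc (2 * m) !)
  [2+2m]! = trans (cong _! (*-suc 2 m)) (cong (_* (suc (2 * m) !)) (sym (*-suc 2 m)))

v2ℕ-n!<n : ∀ n → 0 < n → v2ℕ (n !) < n
v2ℕ-n!<n = <-rec _ step
  where
  step : ∀ n → (∀ {m} → m < n → 0 < m → v2ℕ (m !) < m) → 0 < n → v2ℕ (n !) < n
  step n rec n>0 with evenOdd n
  step _ rec () | even zero
  step _ rec _ | even (suc m) = begin-strict
    v2ℕ ((2 * suc m) !)      ≡⟨ v2ℕ-[2m]! (suc m) ⟩
    suc m + v2ℕ (suc m !)    <⟨ +-monoʳ-< (suc m) (rec (n<2*n (suc m) (s≤s z≤n)) (s≤s z≤n)) ⟩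
    suc m + suc m            ≡⟨ cong (suc m +_) (+-identityʳ (suc m)) ⟨
    2 * suc m                ∎
    where open ≤-Reasoning
  step _ rec _ | odd zero = s≤s z≤n
  step _ rec _ | odd (suc m) = begin-strict
    v2ℕ (suc (2 * suc m) !)  ≡⟨ v2ℕ-[1+2m]! (suc m) ⟩
    v2ℕ ((2 * suc m) !)      <⟨ rec (n<1+n (2 * suc m)) (s≤s z≤n) ⟩
    2 * suc m                <⟨ n<1+n (2 * suc m) ⟩
    suc (2 * suc m)          ∎
    where open ≤-Reasoning

suc-v2ℕ-[2^k]! : ∀ k → suc (v2ℕ ((2 ^ k) !)) ≡ 2 ^ k
suc-v2ℕ-[2^k]! zero = refl
suc-v2ℕ-[2^k]! (suc k) = begin
  suc (v2ℕ ((2 * 2 ^ k) !))    ≡⟨ cong suc (v2ℕ-[2m]! (2 ^ k)) ⟩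
  suc (2 ^ k + v2ℕ ((2 ^ k) !)) ≡⟨ +-suc (2 ^ k) _ ⟨
  2 ^ k + suc (v2ℕ ((2 ^ k) !)) ≡⟨ cong (2 ^ k +_) (suc-v2ℕ-[2^k]! k) ⟩
  2 ^ k + 2 ^ k                 ≡⟨ cong (2 ^ k +_) (+-identityʳ (2 ^ k)) ⟨
  2 * 2 ^ k                     ∎
  where open ≡-Reasoning

-- Equivalently (Kummer): a and b add without carries in base 2.
NoCarry : ℕ → ℕ → Set
NoCarry a b = v2ℕ ((a + b) !) ≡ v2ℕ (a !) + v2ℕ (b !)

noCarry-double : ∀ {a b} → NoCarry a b → NoCarry (2 * a) (2 * b)
noCarry-double {a} {b} ab = begin
  v2ℕ ((2 * a + 2 * b) !)               ≡⟨ cong (λ n → v2ℕ (n !)) (*-distribˡ-+ 2 a b) ⟨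
  v2ℕ ((2 * (a + b)) !)                 ≡⟨ v2ℕ-[2m]! (a + b) ⟩
  (a + b) + v2ℕ ((a + b) !)             ≡⟨ cong ((a + b) +_) ab ⟩
  (a + b) + (v2ℕ (a !) + v2ℕ (b !))     ≡⟨ +-CS.interchange a b (v2ℕ (a !)) (v2ℕ (b !)) ⟩
  (a + v2ℕ (a !)) + (b + v2ℕ (b !))     ≡⟨ cong₂ _+_ (v2ℕ-[2m]! a) (v2ℕ-[2m]! b) ⟨
  v2ℕ ((2 * a) !) + v2ℕ ((2 * b) !)     ∎
  where open ≡-Reasoning

noCarry-double-suc : ∀ {a b} → NoCarry a b → NoCarry (2 * a) (suc (2 * b))
noCarry-double-suc {a} {b} ab = begin
  v2ℕ ((2 * a + suc (2 * b)) !)         ≡⟨ cong (λ n → v2ℕ (n !)) (+-suc (2 * a) (2 * b)) ⟩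
  v2ℕ (suc (2 * a + 2 * b) !)           ≡⟨ cong (λ n → v2ℕ (suc n !)) (*-distribˡ-+ 2 a b) ⟨
  v2ℕ (suc (2 * (a + b)) !)             ≡⟨ v2ℕ-[1+2m]! (a + b) ⟩
  v2ℕ ((2 * (a + b)) !)                 ≡⟨ cong (λ n → v2ℕ (n !)) (*-distribˡ-+ 2 a b) ⟩
  v2ℕ ((2 * a + 2 * b) !)               ≡⟨ noCarry-double {a} {b} ab ⟩
  v2ℕ ((2 * a) !) + v2ℕ ((2 * b) !)     ≡⟨ cong (v2ℕ ((2 * a) !) +_) (v2ℕ-[1+2m]! b) ⟨
  v2ℕ ((2 * a) !) + v2ℕ (suc (2 * b) !) ∎
  where open ≡-Reasoning

noCarry-2^ : ∀ k {r} → r < 2 ^ k → NoCarry (2 ^ k) r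
noCarry-2^ zero {zero} _ = refl
noCarry-2^ zero {suc r} (s≤s ())
noCarry-2^ (suc k) {r} r<2^k+1 with evenOdd r
... | even q = noCarry-double {2 ^ k} {q} (noCarry-2^ k (*-cancelˡ-< 2 q (2 ^ k) r<2^k+1))
... | odd q = noCarry-double-suc {2 ^ k} {q} (noCarry-2^ k (*-cancelˡ-< 2 q (2 ^ k) (<-trans (n<1+n (2 * q)) r<2^k+1)))

v2ℕ≡0⇒odd : ∀ {n} → 0 < n → v2ℕ n ≡ 0 → Odd n
v2ℕ≡0⇒odd {n} n>0 v2ℕn≡0 with v2ℕ-decomposition n n>0
... | o , o-odd , n≡ = subst Odd (sym (trans n≡ (trans (cong (λ a → 2 ^ a * o) v2ℕn≡0) (*-identityˡ o)))) o-odd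

C*k!*[n∸k]!≡n! : ∀ {n k} → k ≤ n → (n C k) * (k ! * (n ∸ k) !) ≡ n !
C*k!*[n∸k]!≡n! {n} {k} k≤n = trans (cong (_* (k ! * (n ∸ k) !)) (nCk≡n!/k![n-k]! k≤n))
                                   (m/n*n≡m {{k !* (n ∸ k) !≢0}} (k![n∸k]!∣n! k≤n))

noCarry⇒odd-C : ∀ a b → NoCarry a b → Odd ((a + b) C a)
noCarry⇒odd-C a b ab = v2ℕ≡0⇒odd c>0 (+-cancelʳ-≡ (v2ℕ (a !) + v2ℕ (b !)) (v2ℕ c) 0 v2ℕc+s≡0+s)
  where
  c : ℕ
  c = (a + b) C a
  c*a!*b!≡[a+b]! : c * (a ! * b !) ≡ (a + b) !
  c*a!*b!≡[a+b]! = subst (λ m → c * (a ! * m !) ≡ (a + b) !) (m+n∸m≡n a b) (C*k!*[n∸k]!≡n! (m≤m+n a b))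
  c>0 : 0 < c
  c>0 = n≢0⇒n>0 λ c≡0 → n>0⇒n≢0 (1≤n! (a + b)) (trans (sym c*a!*b!≡[a+b]!) (cong (_* (a ! * b !)) c≡0))
  v2ℕc+s≡0+s : v2ℕ c + (v2ℕ (a !) + v2ℕ (b !)) ≡ 0 + (v2ℕ (a !) + v2ℕ (b !))
  v2ℕc+s≡0+s = begin
    v2ℕ c + (v2ℕ (a !) + v2ℕ (b !)) ≡⟨ cong (v2ℕ c +_) (v2ℕ-* (1≤n! a) (1≤n! b)) ⟨
    v2ℕ c + v2ℕ (a ! * b !)         ≡⟨ v2ℕ-* c>0 (*-pos (1≤n! a) (1≤n! b)) ⟨
    v2ℕ (c * (a ! * b !))           ≡⟨ cong v2ℕ c*a!*b!≡[a+b]! ⟩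
    v2ℕ ((a + b) !)                 ≡⟨ ab ⟩
    v2ℕ (a !) + v2ℕ (b !)           ∎
    where open ≡-Reasoning

odd-tC2^k : ∀ k t → 2 ^ k ≤ t → t < 2 ^ suc k → Odd (t C 2 ^ k)
odd-tC2^k k t 2^k≤t t<2^k+1 =
  subst (λ s → Odd (s C 2 ^ k)) 2^k+r≡t (noCarry⇒odd-C (2 ^ k) r (noCarry-2^ k r<2^k))
  where
  r : ℕ
  r = t ∸ 2 ^ k
  2^k+r≡t : 2 ^ k + r ≡ t
  2^k+r≡t = m+[n∸m]≡n 2^k≤t
  r<2^k : r < 2 ^ k
  r<2^k = +-cancelˡ-< (2 ^ k) r (2 ^ k)
            (subst₂ _<_ (sym 2^k+r≡t) (cong (2 ^ k +_) (+-identityʳ (2 ^ k))) t<2^k+1)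

-- 2-adic valuation of rationals

-- Imported only here: ℤ's prefix +_ makes the ℕ sections (x +_) used above ambiguous.
open import Data.Integer as ℤ using (ℤ; +_; ∣_∣)
import Data.Integer.Properties as ℤP
import Data.Integer.Divisibility as ℤD
import Data.Integer.Divisibility.Signed as ℤ∣
open import Data.Rational as ℚ using (ℚ; mkℚ; 0ℚ; 1ℚ; ↥_; ↧ₙ_; toℚᵘ)
import Data.Rational.Properties as ℚP
import Data.Rational.Unnormalised.Properties as ℚᵘP
open import Data.Rational.Unnormalised using (ℚᵘ; mkℚᵘ; *≡*) renaming (↥_ to ↥ᵘ_; ↧ₙ_ to ↧ₙᵘ_; ↧_ to ↧ᵘ_; _≃_ to _≃ᵘ_)
import Data.Integer.Solver as ℤSolver
open import Algebra.Properties.Group ℚP.+-0-group using (//-rightDividesʳ)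
module ℤ+-CS = CommSemigroupProperties ℤP.+-commutativeSemigroup
open import Data.Sum using (_⊎_; inj₁; inj₂; [_,_]′)
open import Data.List using ([]; _∷_)

vℤ : ℤ → ℕ
vℤ z = v2ℕ ∣ z ∣

vℤ-* : ∀ x y → 0 < ∣ x ∣ → 0 < ∣ y ∣ → vℤ (x ℤ.* y) ≡ vℤ x + vℤ y
vℤ-* x y x≢0 y≢0 = trans (cong v2ℕ (ℤP.abs-* x y)) (v2ℕ-* x≢0 y≢0)

∣x*y∣>0 : ∀ x y → 0 < ∣ x ∣ → 0 < ∣ y ∣ → 0 < ∣ x ℤ.* y ∣
∣x*y∣>0 x y x≢0 y≢0 = subst (0 <_) (sym (ℤP.abs-* x y)) (*-pos x≢0 y≢0)

2^m∣x : ∀ {m} x → 0 < ∣ x ∣ → m ≤ vℤ x → + (2 ^ m) ℤ∣.∣ x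
2^m∣x x x≢0 m≤vx = ℤ∣.∣ᵤ⇒∣ (∣-trans (2^m∣2^n m≤vx) (2^v2ℕ∣n x≢0))

vℤ-+-≥ : ∀ {m} x y → 0 < ∣ x ∣ → 0 < ∣ y ∣ → 0 < ∣ x ℤ.+ y ∣ → m ≤ vℤ x → m ≤ vℤ y → m ≤ vℤ (x ℤ.+ y)
vℤ-+-≥ x y x≢0 y≢0 x+y≢0 m≤vx m≤vy =
  2^m∣n⇒m≤v2ℕn _ _ x+y≢0 (ℤ∣.∣⇒∣ᵤ (ℤ∣.∣m∣n⇒∣m+n (2^m∣x x x≢0 m≤vx) (2^m∣x y y≢0 m≤vy)))

vℤ-+ : ∀ x y → 0 < ∣ x ∣ → 0 < ∣ y ∣ → 0 < ∣ x ℤ.+ y ∣ → vℤ x ≤ vℤ (x ℤ.+ y) ⊎ vℤ y ≤ vℤ (x ℤ.+ y)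
vℤ-+ x y x≢0 y≢0 x+y≢0 with ≤-total (vℤ x) (vℤ y)
... | inj₁ vx≤vy = inj₁ (vℤ-+-≥ x y x≢0 y≢0 x+y≢0 ≤-refl vx≤vy)
... | inj₂ vy≤vx = inj₂ (vℤ-+-≥ x y x≢0 y≢0 x+y≢0 vy≤vx ≤-refl)

+a-+b≡+c-+d : ∀ a b c d → a + d ≡ c + b → + a ℤ.- + b ≡ + c ℤ.- + d
+a-+b≡+c-+d a b c d a+d≡c+b = begin
  + a ℤ.- + b                       ≡⟨ solve 3 (λ a b d → a :- b := (a :+ d) :- (b :+ d)) refl (+ a) (+ b) (+ d) ⟩
  (+ a ℤ.+ + d) ℤ.- (+ b ℤ.+ + d)   ≡⟨ cong (ℤ._- (+ b ℤ.+ + d)) (trans (sym (ℤP.pos-+ a d)) (trans (cong +_ a+d≡c+b) (ℤP.pos-+ c b))) ⟩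
  (+ c ℤ.+ + b) ℤ.- (+ b ℤ.+ + d)   ≡⟨ solve 3 (λ b c d → (c :+ b) :- (b :+ d) := c :- d) refl (+ b) (+ c) (+ d) ⟩
  + c ℤ.- + d                       ∎
  where
  open ≡-Reasoning
  open ℤSolver.+-*-Solver

v2ᵘ : ℚᵘ → ℤ
v2ᵘ r = + vℤ (↥ᵘ r) ℤ.- + v2ℕ (↧ₙᵘ r)

v2≡v2ᵘ∘toℚᵘ : ∀ q → v2 q ≡ v2ᵘ (toℚᵘ q)
v2≡v2ᵘ∘toℚᵘ (mkℚ _ _ _) = refl

v2ᵘ-cong : ∀ {p q} → 0 < ∣ ↥ᵘ p ∣ → p ≃ᵘ q → v2ᵘ p ≡ v2ᵘ q
v2ᵘ-cong {p} {q} ↥p≢0 (*≡* ↥p↧q≡↥q↧p) = +a-+b≡+c-+d _ (v2ℕ (↧ₙᵘ p)) _ (v2ℕ (↧ₙᵘ q)) (begin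
  vℤ (↥ᵘ p) + v2ℕ (↧ₙᵘ q)     ≡⟨ v2ℕ-* ↥p≢0 (s≤s z≤n) ⟨
  v2ℕ (∣ ↥ᵘ p ∣ * ↧ₙᵘ q)       ≡⟨ cong v2ℕ ∣↥p∣↧q≡∣↥q∣↧p ⟩
  v2ℕ (∣ ↥ᵘ q ∣ * ↧ₙᵘ p)       ≡⟨ v2ℕ-* ↥q≢0 (s≤s z≤n) ⟩
  vℤ (↥ᵘ q) + v2ℕ (↧ₙᵘ p)     ∎)
  where
  open ≡-Reasoning
  ∣↥p∣↧q≡∣↥q∣↧p : ∣ ↥ᵘ p ∣ * ↧ₙᵘ q ≡ ∣ ↥ᵘ q ∣ * ↧ₙᵘ p
  ∣↥p∣↧q≡∣↥q∣↧p = trans (sym (ℤP.abs-* (↥ᵘ p) (↧ᵘ q))) (trans (cong ∣_∣ ↥p↧q≡↥q↧p) (ℤP.abs-* (↥ᵘ q) (↧ᵘ p)))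
  ↥q≢0 : 0 < ∣ ↥ᵘ q ∣
  ↥q≢0 = m*n>0⇒m>0 (subst (0 <_) ∣↥p∣↧q≡∣↥q∣↧p (*-pos ↥p≢0 (s≤s z≤n)))

↥>0⇒≢0 : ∀ {q} → 0 < ∣ ↥ q ∣ → q ≢ 0ℚ
↥>0⇒≢0 ↥q>0 refl = <-irrefl refl ↥q>0

≢0⇒↥>0 : ∀ {q} → q ≢ 0ℚ → 0 < ∣ ↥ q ∣
≢0⇒↥>0 {q} q≢0 = n≢0⇒n>0 λ ∣↥q∣≡0 → q≢0 (ℚP.↥p≡0⇒p≡0 q (ℤP.∣i∣≡0⇒i≡0 ∣↥q∣≡0))

≃⇒∣↥∣*↧≡∣↥∣*↧ : ∀ q {r} → toℚᵘ q ≃ᵘ r → ∣ ↥ q ∣ * ↧ₙᵘ r ≡ ∣ ↥ᵘ r ∣ * ↧ₙ q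
≃⇒∣↥∣*↧≡∣↥∣*↧ (mkℚ a _ _) {r} (*≡* a↧r≡↥r↧q) =
  trans (sym (ℤP.abs-* a (↧ᵘ r))) (trans (cong ∣_∣ a↧r≡↥r↧q) (ℤP.abs-* (↥ᵘ r) _))

≃-≢0 : ∀ {q r} → 0 < ∣ ↥ᵘ r ∣ → toℚᵘ q ≃ᵘ r → q ≢ 0ℚ
≃-≢0 {q} r≢0 q≃r = ↥>0⇒≢0 (m*n>0⇒m>0 (subst (0 <_) (sym (≃⇒∣↥∣*↧≡∣↥∣*↧ q q≃r)) (*-pos r≢0 (s≤s z≤n))))

≢0-≃ : ∀ {q r} → q ≢ 0ℚ → toℚᵘ q ≃ᵘ r → 0 < ∣ ↥ᵘ r ∣
≢0-≃ {q} q≢0 q≃r = m*n>0⇒m>0 (subst (0 <_) (≃⇒∣↥∣*↧≡∣↥∣*↧ q q≃r) (*-pos (≢0⇒↥>0 q≢0) (s≤s z≤n)))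

v2-via : ∀ q {r} → 0 < ∣ ↥ᵘ r ∣ → toℚᵘ q ≃ᵘ r → v2 q ≡ v2ᵘ r
v2-via q r≢0 q≃r = trans (v2≡v2ᵘ∘toℚᵘ q) (sym (v2ᵘ-cong r≢0 (ℚᵘP.≃-sym q≃r)))

+[a+b]-+[c+d] : ∀ a b c d → + (a + b) ℤ.- + (c + d) ≡ (+ a ℤ.- + c) ℤ.+ (+ b ℤ.- + d)
+[a+b]-+[c+d] a b c d = begin
  + (a + b) ℤ.- + (c + d)             ≡⟨ cong₂ ℤ._-_ (ℤP.pos-+ a b) (ℤP.pos-+ c d) ⟩
  (+ a ℤ.+ + b) ℤ.- (+ c ℤ.+ + d)     ≡⟨ solve 4 (λ a b c d → (a :+ b) :- (c :+ d) := (a :- c) :+ (b :- d)) refl (+ a) (+ b) (+ c) (+ d) ⟩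
  (+ a ℤ.- + c) ℤ.+ (+ b ℤ.- + d)     ∎
  where
  open ≡-Reasoning
  open ℤSolver.+-*-Solver

*-≢0 : ∀ {p q} → p ≢ 0ℚ → q ≢ 0ℚ → p ℚ.* q ≢ 0ℚ
*-≢0 {p@(mkℚ _ _ _)} {q@(mkℚ _ _ _)} p≢0 q≢0 =
  ≃-≢0 (∣x*y∣>0 (↥ p) (↥ q) (≢0⇒↥>0 p≢0) (≢0⇒↥>0 q≢0)) (ℚP.toℚᵘ-homo-* p q)

v2-* : ∀ {p q} → p ≢ 0ℚ → q ≢ 0ℚ → v2 (p ℚ.* q) ≡ v2 p ℤ.+ v2 q
v2-* {p@(mkℚ a d _)} {q@(mkℚ b e _)} p≢0 q≢0 = begin
  v2 (p ℚ.* q)                                          ≡⟨ v2-via (p ℚ.* q) (∣x*y∣>0 a b a≢0 b≢0) (ℚP.toℚᵘ-homo-* p q) ⟩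
  + vℤ (a ℤ.* b) ℤ.- + v2ℕ (suc d * suc e)              ≡⟨ cong₂ (λ m n → + m ℤ.- + n) (vℤ-* a b a≢0 b≢0) (v2ℕ-* {suc d} (s≤s z≤n) (s≤s z≤n)) ⟩
  + (vℤ a + vℤ b) ℤ.- + (v2ℕ (suc d) + v2ℕ (suc e))     ≡⟨ +[a+b]-+[c+d] (vℤ a) (vℤ b) (v2ℕ (suc d)) (v2ℕ (suc e)) ⟩
  v2 p ℤ.+ v2 q                                         ∎
  where
  open ≡-Reasoning
  a≢0 : 0 < ∣ a ∣
  a≢0 = ≢0⇒↥>0 p≢0
  b≢0 : 0 < ∣ b ∣
  b≢0 = ≢0⇒↥>0 q≢0

v2-neg : ∀ q → v2 (ℚ.- q) ≡ v2 q
v2-neg (mkℚ (+ zero)  _ _) = refl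
v2-neg (mkℚ (+ suc _) _ _) = refl
v2-neg (mkℚ ℤ.-[1+ _ ] _ _) = refl

v2-common-denominator : ∀ a m n → 0 < ∣ a ∣ → 0 < m → 0 < n →
  + vℤ (a ℤ.* + n) ℤ.- + v2ℕ (m * n) ≡ + vℤ a ℤ.- + v2ℕ m
v2-common-denominator a m n a≢0 m>0 n>0 =
 +a-+b≡+c-+d (vℤ (a ℤ.* + n)) (v2ℕ (m * n)) (vℤ a) (v2ℕ m) (begin
    vℤ (a ℤ.* + n) + v2ℕ m        ≡⟨ cong (_+ v2ℕ m) (vℤ-* a (+ n) a≢0 n>0) ⟩
    vℤ a + v2ℕ n + v2ℕ m          ≡⟨ +-CS.xy∙z≈x∙zy (vℤ a) (v2ℕ n) (v2ℕ m) ⟩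
    vℤ a + (v2ℕ m + v2ℕ n)        ≡⟨ cong (λ k → vℤ a + k) (v2ℕ-* m>0 n>0) ⟨
    vℤ a + v2ℕ (m * n)            ∎)
  where open ≡-Reasoning

-- Over the common denominator D, the numerators of p, q and p + q are x, y and x + y,
-- so the ultrametric inequality for vℤ applies.
v2-+-≥ : ∀ {w} p q → p ≢ 0ℚ → q ≢ 0ℚ → p ℚ.+ q ≢ 0ℚ → w ℤ.≤ v2 p → w ℤ.≤ v2 q → w ℤ.≤ v2 (p ℚ.+ q)
v2-+-≥ {w} p@(mkℚ a d _) q@(mkℚ b e _) p≢0 q≢0 p+q≢0 w≤v2p w≤v2q =
  subst (w ℤ.≤_) (sym v2[p+q]) ([ raise x (subst (w ℤ.≤_) v2p w≤v2p) , raise y (subst (w ℤ.≤_) v2q w≤v2q) ]′ (vℤ-+ x y x≢0 y≢0 x+y≢0))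
  where
  x y : ℤ
  x = a ℤ.* + suc e
  y = b ℤ.* + suc d
  D : ℕ
  D = suc d * suc e
  a≢0 : 0 < ∣ a ∣
  a≢0 = ≢0⇒↥>0 p≢0
  b≢0 : 0 < ∣ b ∣
  b≢0 = ≢0⇒↥>0 q≢0
  x≢0 : 0 < ∣ x ∣
  x≢0 = ∣x*y∣>0 a (+ suc e) a≢0 (s≤s z≤n)
  y≢0 : 0 < ∣ y ∣
  y≢0 = ∣x*y∣>0 b (+ suc d) b≢0 (s≤s z≤n)
  x+y≢0 : 0 < ∣ x ℤ.+ y ∣
  x+y≢0 = ≢0-≃ p+q≢0 (ℚP.toℚᵘ-homo-+ p q)
  v2[p+q] : v2 (p ℚ.+ q) ≡ + vℤ (x ℤ.+ y) ℤ.- + v2ℕ D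
  v2[p+q] = v2-via (p ℚ.+ q) x+y≢0 (ℚP.toℚᵘ-homo-+ p q)
  v2p : v2 p ≡ + vℤ x ℤ.- + v2ℕ D
  v2p = sym (v2-common-denominator a (suc d) (suc e) a≢0 (s≤s z≤n) (s≤s z≤n))
  v2q : v2 q ≡ + vℤ y ℤ.- + v2ℕ D
  v2q = trans (sym (v2-common-denominator b (suc e) (suc d) b≢0 (s≤s z≤n) (s≤s z≤n)))
              (cong (λ n → + vℤ y ℤ.- + v2ℕ n) (*-comm (suc e) (suc d)))
  raise : ∀ z → w ℤ.≤ + vℤ z ℤ.- + v2ℕ D → vℤ z ≤ vℤ (x ℤ.+ y) → w ℤ.≤ + vℤ (x ℤ.+ y) ℤ.- + v2ℕ D
  raise z w≤z vz≤ = ℤP.≤-trans w≤z (ℤP.+-monoˡ-≤ (ℤ.- + v2ℕ D) (ℤ.+≤+ vz≤))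

infix 4 _≤v₂_ _≡v₂_

-- v2 0ℚ = 0 is a junk value: bounds are only asserted for nonzero q, as if v₂(0) = ∞.
_≤v₂_ : ℤ → ℚ → Set
w ≤v₂ q = q ≢ 0ℚ → w ℤ.≤ v2 q

_≡v₂_ : ℤ → ℚ → Set
w ≡v₂ q = q ≢ 0ℚ × v2 q ≡ w

≤v₂-+ : ∀ {w p q} → w ≤v₂ p → w ≤v₂ q → w ≤v₂ p ℚ.+ q
≤v₂-+ {w} {p} {q} w≤p w≤q p+q≢0 with p ℚ.≟ 0ℚ | q ℚ.≟ 0ℚ
... | yes refl | _        = subst (λ r → w ℤ.≤ v2 r) (sym (ℚP.+-identityˡ q)) (w≤q (p+q≢0 ∘ trans (ℚP.+-identityˡ q)))
... | no _     | yes refl = subst (λ r → w ℤ.≤ v2 r) (sym (ℚP.+-identityʳ p)) (w≤p (p+q≢0 ∘ trans (ℚP.+-identityʳ p)))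
... | no p≢0   | no q≢0   = v2-+-≥ p q p≢0 q≢0 p+q≢0 (w≤p p≢0) (w≤q q≢0)

≤v₂-0ℚ : ∀ w → w ≤v₂ 0ℚ
≤v₂-0ℚ w 0≢0 = ⊥-elim (0≢0 refl)

≡v₂⇒≤v₂ : ∀ {w q} → w ≡v₂ q → w ≤v₂ q
≡v₂⇒≤v₂ (_ , v2q≡w) _ = ℤP.≤-reflexive (sym v2q≡w)

≤v₂-weaken : ∀ {a b q} → a ℤ.≤ b → b ≤v₂ q → a ≤v₂ q
≤v₂-weaken a≤b b≤q q≢0 = ℤP.≤-trans a≤b (b≤q q≢0)

≤v₂-* : ∀ {a b p q} → a ≤v₂ p → b ≤v₂ q → a ℤ.+ b ≤v₂ p ℚ.* q
≤v₂-* {a} {b} {p} {q} a≤p b≤q pq≢0 with p ℚ.≟ 0ℚ | q ℚ.≟ 0ℚ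
... | yes refl | _        = ⊥-elim (pq≢0 (ℚP.*-zeroˡ q))
... | no _     | yes refl = ⊥-elim (pq≢0 (ℚP.*-zeroʳ p))
... | no p≢0   | no q≢0   = subst (a ℤ.+ b ℤ.≤_) (sym (v2-* p≢0 q≢0)) (ℤP.+-mono-≤ (a≤p p≢0) (b≤q q≢0))

≡v₂-* : ∀ {a b p q} → a ≡v₂ p → b ≡v₂ q → a ℤ.+ b ≡v₂ p ℚ.* q
≡v₂-* (p≢0 , v2p≡a) (q≢0 , v2q≡b) = *-≢0 p≢0 q≢0 , trans (v2-* p≢0 q≢0) (cong₂ ℤ._+_ v2p≡a v2q≡b)

≤v₂-neg : ∀ {w q} → w ≤v₂ q → w ≤v₂ ℚ.- q
≤v₂-neg {w} {q} w≤q -q≢0 = subst (w ℤ.≤_) (sym (v2-neg q)) (w≤q (λ q≡0 → -q≢0 (cong (λ r → ℚ.- r) q≡0)))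

≡v₂-+ : ∀ {w p q} → w ≡v₂ p → ℤ.suc w ≤v₂ q → w ≡v₂ p ℚ.+ q
≡v₂-+ {w} {p} {q} (p≢0 , v2p≡w) w<q = p+q≢0 , ℤP.≤-antisym v2[p+q]≤w w≤v2[p+q]
  where
  -- p = (p + q) - q with v₂(q) > w, so v₂(p + q) > w would give v₂(p) > w
  p+q>w-impossible : ¬ (ℤ.suc w ≤v₂ p ℚ.+ q)
  p+q>w-impossible w<p+q = ℤP.<-irrefl (sym v2p≡w) (ℤP.suc[i]≤j⇒i<j (subst (λ r → ℤ.suc w ℤ.≤ v2 r) (//-rightDividesʳ q p)
    (≤v₂-+ w<p+q (≤v₂-neg w<q) (subst (_≢ 0ℚ) (sym (//-rightDividesʳ q p)) p≢0))))
  p+q≢0 : p ℚ.+ q ≢ 0ℚ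
  p+q≢0 p+q≡0 = p+q>w-impossible (λ p+q≢0 → ⊥-elim (p+q≢0 p+q≡0))
  w≤v2[p+q] : w ℤ.≤ v2 (p ℚ.+ q)
  w≤v2[p+q] = ≤v₂-+ (≡v₂⇒≤v₂ (p≢0 , v2p≡w)) (≤v₂-weaken (ℤP.i≤suc[i] w) w<q) p+q≢0
  v2[p+q]≤w : v2 (p ℚ.+ q) ℤ.≤ w
  v2[p+q]≤w = ℤP.≮⇒≥ λ w<v2[p+q] → p+q>w-impossible (λ _ → ℤP.i<j⇒suc[i]≤j w<v2[p+q])

≡v₂-/ : ∀ i n .{{_ : NonZero n}} → 0 < ∣ i ∣ → + vℤ i ℤ.- + v2ℕ n ≡v₂ i ℚ./ n
≡v₂-/ i (suc n) i≢0 = ≃-≢0 i≢0 i/n≃i/n , v2-via (i ℚ./ suc n) i≢0 i/n≃i/n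
  where
  i/n≃i/n : toℚᵘ (i ℚ./ suc n) ≃ᵘ mkℚᵘ i n
  i/n≃i/n = ℚP.toℚᵘ-fromℚᵘ (mkℚᵘ i n)

≡v₂-ℤ→ℚ : ∀ z → 0 < ∣ z ∣ → + vℤ z ≡v₂ ℤ→ℚ z
≡v₂-ℤ→ℚ z z≢0 = subst (_≡v₂ ℤ→ℚ z) (ℤP.+-identityʳ (+ vℤ z)) (≡v₂-/ z 1 z≢0)

∣[-2]^j∣ : ∀ j → ∣ (ℤ.- + 2) ℤ.^ j ∣ ≡ 2 ^ j
∣[-2]^j∣ zero = refl
∣[-2]^j∣ (suc j) = trans (ℤP.abs-* (ℤ.- + 2) ((ℤ.- + 2) ℤ.^ j)) (cong (2 *_) (∣[-2]^j∣ j))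

≡v₂-[-2]^ : ∀ j → + j ≡v₂ ℤ→ℚ ((ℤ.- + 2) ℤ.^ j)
≡v₂-[-2]^ j = subst (λ v → + v ≡v₂ ℤ→ℚ ((ℤ.- + 2) ℤ.^ j)) (trans (cong v2ℕ (∣[-2]^j∣ j)) (v2ℕ-2^ j))
  (≡v₂-ℤ→ℚ ((ℤ.- + 2) ℤ.^ j) (subst (0 <_) (sym (∣[-2]^j∣ j)) (m^n>0 2 j)))

≡v₂-odd : ∀ {n} → Odd n → + 0 ≡v₂ ℕ→ℚ n
≡v₂-odd {n} n-odd = subst (λ v → + v ≡v₂ ℕ→ℚ n) (v2ℕ-odd n-odd) (≡v₂-ℤ→ℚ (+ n) (odd>0 n-odd))

≤v₂-ℕ→ℚ : ∀ n → + 0 ≤v₂ ℕ→ℚ n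
≤v₂-ℕ→ℚ zero 0≢0 = ⊥-elim (0≢0 refl)
≤v₂-ℕ→ℚ (suc n) = ≤v₂-weaken (ℤ.+≤+ z≤n) (≡v₂⇒≤v₂ (≡v₂-ℤ→ℚ (+ suc n) (s≤s z≤n)))

≡v₂-1ℚ : + 0 ≡v₂ 1ℚ
≡v₂-1ℚ = (λ ()) , refl

≡v₂-1/n! : ∀ n → ℤ.- + v2ℕ (n !) ≡v₂ ℚ._/_ (+ 1) (n !) {{n !≢0}}
≡v₂-1/n! n = subst (_≡v₂ ℚ._/_ (+ 1) (n !) {{n !≢0}}) (ℤP.+-identityˡ (ℤ.- + v2ℕ (n !))) (≡v₂-/ (+ 1) (n !) {{n !≢0}} (s≤s z≤n))

-- Polynomials

coeff-+ₚ : ∀ f g j → coeff (f +ₚ g) j ≡ coeff f j ℚ.+ coeff g j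
coeff-+ₚ []      g       j       = sym (ℚP.+-identityˡ (coeff g j))
coeff-+ₚ (a ∷ f) []      j       = sym (ℚP.+-identityʳ (coeff (a ∷ f) j))
coeff-+ₚ (a ∷ f) (b ∷ g) zero    = refl
coeff-+ₚ (a ∷ f) (b ∷ g) (suc j) = coeff-+ₚ f g j

coeff-scale : ∀ c f j → coeff (scale c f) j ≡ c ℚ.* coeff f j
coeff-scale c []      j       = sym (ℚP.*-zeroʳ c)
coeff-scale c (a ∷ f) zero    = refl
coeff-scale c (a ∷ f) (suc j) = coeff-scale c f j

coeff-∷*ₚ : ∀ a f g j → coeff ((a ∷ f) *ₚ g) j ≡ a ℚ.* coeff g j ℚ.+ coeff (0ℚ ∷ (f *ₚ g)) j
coeff-∷*ₚ a f g j = trans (coeff-+ₚ (scale a g) (0ℚ ∷ (f *ₚ g)) j) (cong (ℚ._+ _) (coeff-scale a g j))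

coeff-*ₚ-0 : ∀ f g → coeff (f *ₚ g) 0 ≡ coeff f 0 ℚ.* coeff g 0
coeff-*ₚ-0 []      g = sym (ℚP.*-zeroˡ (coeff g 0))
coeff-*ₚ-0 (a ∷ f) g = trans (coeff-∷*ₚ a f g 0) (ℚP.+-identityʳ _)

IsZero : Poly → Set
IsZero f = ∀ j → coeff f j ≡ 0ℚ

NonZeroPoly : Poly → Set
NonZeroPoly f = ∃[ j ] coeff f j ≢ 0ℚ

isZero? : ∀ f → NonZeroPoly f ⊎ IsZero f
isZero? [] = inj₂ λ _ → refl
isZero? (a ∷ f) with a ℚ.≟ 0ℚ | isZero? f
... | no a≢0  | _ = inj₁ (0 , a≢0)
... | yes _   | inj₁ (j , fⱼ≢0) = inj₁ (suc j , fⱼ≢0)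
... | yes a≡0 | inj₂ f≡0 = inj₂ λ { zero → a≡0 ; (suc j) → f≡0 j }

isZero-∷ : ∀ {f} → IsZero f → IsZero (0ℚ ∷ f)
isZero-∷ f≡0 zero    = refl
isZero-∷ f≡0 (suc j) = f≡0 j

isZero-*ₚ : ∀ f g → IsZero f → IsZero (f *ₚ g)
isZero-*ₚ []      g f≡0 j = refl
isZero-*ₚ (a ∷ f) g a∷f≡0 j = begin
  coeff ((a ∷ f) *ₚ g) j                     ≡⟨ coeff-∷*ₚ a f g j ⟩
  a ℚ.* coeff g j ℚ.+ coeff (0ℚ ∷ (f *ₚ g)) j ≡⟨ cong₂ ℚ._+_ (cong (ℚ._* coeff g j) (a∷f≡0 0)) (isZero-∷ (isZero-*ₚ f g (a∷f≡0 ∘ suc)) j) ⟩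
  0ℚ ℚ.* coeff g j ℚ.+ 0ℚ                    ≡⟨ cong (ℚ._+ 0ℚ) (ℚP.*-zeroˡ (coeff g j)) ⟩
  0ℚ ℚ.+ 0ℚ                                  ≡⟨⟩
  0ℚ                                         ∎
  where open ≡-Reasoning

infix 4 _≤v₂ₚ_

_≤v₂ₚ_ : ℤ → Poly → Set
w ≤v₂ₚ f = ∀ j → w ≤v₂ coeff f j

≤v₂ₚ-+ₚ : ∀ {w} f g → w ≤v₂ₚ f → w ≤v₂ₚ g → w ≤v₂ₚ f +ₚ g
≤v₂ₚ-+ₚ {w} f g w≤f w≤g j = subst (w ≤v₂_) (sym (coeff-+ₚ f g j)) (≤v₂-+ (w≤f j) (w≤g j))

≤v₂ₚ-scale : ∀ {a b c} f → a ≤v₂ c → b ≤v₂ₚ f → a ℤ.+ b ≤v₂ₚ scale c f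
≤v₂ₚ-scale {a} {b} {c} f a≤c b≤f j = subst (a ℤ.+ b ≤v₂_) (sym (coeff-scale c f j)) (≤v₂-* a≤c (b≤f j))

≤v₂ₚ-∷ : ∀ {w f} → w ≤v₂ₚ f → w ≤v₂ₚ 0ℚ ∷ f
≤v₂ₚ-∷ {w} w≤f zero    = ≤v₂-0ℚ w
≤v₂ₚ-∷     w≤f (suc j) = w≤f j

≤v₂ₚ-*ₚ : ∀ {a b} f g → a ≤v₂ₚ f → b ≤v₂ₚ g → a ℤ.+ b ≤v₂ₚ f *ₚ g
≤v₂ₚ-*ₚ {a} {b} []      g a≤f b≤g j = ≤v₂-0ℚ (a ℤ.+ b)
≤v₂ₚ-*ₚ         (c ∷ f) g a≤f b≤g   =
  ≤v₂ₚ-+ₚ (scale c g) (0ℚ ∷ (f *ₚ g)) (≤v₂ₚ-scale g (a≤f 0) b≤g) (≤v₂ₚ-∷ (≤v₂ₚ-*ₚ f g (a≤f ∘ suc) b≤g))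

≤v₂ₚ-weaken : ∀ {a b} f → a ℤ.≤ b → b ≤v₂ₚ f → a ≤v₂ₚ f
≤v₂ₚ-weaken f a≤b b≤f j = ≤v₂-weaken a≤b (b≤f j)

DegreeAtMost : ℕ → Poly → Set
DegreeAtMost r f = ∀ j → r < j → coeff f j ≡ 0ℚ

degree-+ₚ : ∀ {r} f g → DegreeAtMost r f → DegreeAtMost r g → DegreeAtMost r (f +ₚ g)
degree-+ₚ f g deg-f deg-g j r<j = trans (coeff-+ₚ f g j) (cong₂ ℚ._+_ (deg-f j r<j) (deg-g j r<j))

degree-scale : ∀ {r} c f → DegreeAtMost r f → DegreeAtMost r (scale c f)
degree-scale c f deg-f j r<j = trans (coeff-scale c f j) (trans (cong (c ℚ.*_) (deg-f j r<j)) (ℚP.*-zeroʳ c))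

degree-mono : ∀ {r s f} → r ≤ s → DegreeAtMost r f → DegreeAtMost s f
degree-mono r≤s deg-f j s<j = deg-f j (≤-<-trans r≤s s<j)

a*0+0≡0 : ∀ a {b c} → b ≡ 0ℚ → c ≡ 0ℚ → a ℚ.* b ℚ.+ c ≡ 0ℚ
a*0+0≡0 a refl refl = trans (ℚP.+-identityʳ (a ℚ.* 0ℚ)) (ℚP.*-zeroʳ a)

degree-*ₚ : ∀ {r s} f g → DegreeAtMost r f → DegreeAtMost s g → DegreeAtMost (r + s) (f *ₚ g)
degree-*ₚ []                    g deg-f deg-g j       _            = refl
degree-*ₚ {zero}  {s} (a ∷ f) g deg-f deg-g j       s<j          =
  trans (coeff-∷*ₚ a f g j) (a*0+0≡0 a (deg-g j s<j) (isZero-∷ (isZero-*ₚ f g λ k → deg-f (suc k) (s≤s z≤n)) j))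
degree-*ₚ {suc r} {s} (a ∷ f) g deg-f deg-g (suc j) (s≤s r+s<j) =
  trans (coeff-∷*ₚ a f g (suc j))
        (a*0+0≡0 a (deg-g (suc j) (≤-<-trans (m≤n+m s r) (m<n⇒m<1+n r+s<j)))
                   (degree-*ₚ f g (λ k r<k → deg-f (suc k) (s≤s r<k)) deg-g j r+s<j))

coeff-*ₚ-top : ∀ {r s} f g → DegreeAtMost r f → DegreeAtMost s g → coeff (f *ₚ g) (r + s) ≡ coeff f r ℚ.* coeff g s
coeff-*ₚ-top {r} {s} [] g deg-f deg-g = sym (ℚP.*-zeroˡ (coeff g s))
coeff-*ₚ-top {zero} {s} (a ∷ f) g deg-f deg-g =
  trans (coeff-∷*ₚ a f g s)
        (trans (cong (a ℚ.* coeff g s ℚ.+_) (isZero-∷ (isZero-*ₚ f g λ k → deg-f (suc k) (s≤s z≤n)) s)) (ℚP.+-identityʳ _))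
coeff-*ₚ-top {suc r} {s} (a ∷ f) g deg-f deg-g = begin
  coeff ((a ∷ f) *ₚ g) (suc (r + s))                                    ≡⟨ coeff-∷*ₚ a f g (suc (r + s)) ⟩
  a ℚ.* coeff g (suc (r + s)) ℚ.+ coeff (f *ₚ g) (r + s)                ≡⟨ cong (λ c → a ℚ.* c ℚ.+ coeff (f *ₚ g) (r + s)) (deg-g (suc (r + s)) (s≤s (m≤n+m s r))) ⟩
  a ℚ.* 0ℚ ℚ.+ coeff (f *ₚ g) (r + s)                                   ≡⟨ cong (ℚ._+ coeff (f *ₚ g) (r + s)) (ℚP.*-zeroʳ a) ⟩
  0ℚ ℚ.+ coeff (f *ₚ g) (r + s)                                         ≡⟨ ℚP.+-identityˡ _ ⟩
  coeff (f *ₚ g) (r + s)                                                ≡⟨ coeff-*ₚ-top f g (λ k r<k → deg-f (suc k) (s≤s r<k)) deg-g ⟩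
  coeff f r ℚ.* coeff g s                                               ∎
  where open ≡-Reasoning

head≢0 : ∀ {a f} → NonZeroPoly (a ∷ f) → IsZero f → a ≢ 0ℚ
head≢0 (zero  , a≢0)  f≡0 = a≢0
head≢0 (suc j , fⱼ≢0) f≡0 = ⊥-elim (fⱼ≢0 (f≡0 j))

degree-exists : ∀ f → NonZeroPoly f → ∃[ r ] coeff f r ≢ 0ℚ × DegreeAtMost r f
degree-exists []      (j , 0≢0) = ⊥-elim (0≢0 refl)
degree-exists (a ∷ f) a∷f≢0 with isZero? f
... | inj₂ f≡0 = 0 , head≢0 a∷f≢0 f≡0 , λ { (suc j) _ → f≡0 j }
... | inj₁ f≢0 with degree-exists f f≢0
...   | r , fᵣ≢0 , deg-f = suc r , fᵣ≢0 , λ { (suc j) (s≤s r<j) → deg-f j r<j }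

LastMinimal : ℤ → ℕ → Poly → Set
LastMinimal μ i f = μ ≤v₂ₚ f × μ ≡v₂ coeff f i × (∀ j → i < j → ℤ.suc μ ≤v₂ coeff f j)

lastMinimal-head : ∀ {a f} → a ≢ 0ℚ → ℤ.suc (v2 a) ≤v₂ₚ f → LastMinimal (v2 a) 0 (a ∷ f)
lastMinimal-head {a} a≢0 v2a<f = bound , (a≢0 , refl) , λ { (suc j) _ → v2a<f j }
  where
  bound : v2 a ≤v₂ₚ a ∷ _
  bound zero    _ = ℤP.≤-refl
  bound (suc j)   = ≤v₂-weaken (ℤP.i≤suc[i] (v2 a)) (v2a<f j)

lastMinimal-∷ : ∀ {μ i a f} → μ ≤v₂ a → LastMinimal μ i f → LastMinimal μ (suc i) (a ∷ f)
lastMinimal-∷ μ≤a (μ≤f , μ≡fᵢ , μ<f) = (λ { zero → μ≤a ; (suc j) → μ≤f j }) , μ≡fᵢ , λ { (suc j) (s≤s i<j) → μ<f j i<j }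

lastMinimal-exists : ∀ f → NonZeroPoly f → ∃₂ λ μ i → LastMinimal μ i f
lastMinimal-exists []      (j , 0≢0) = ⊥-elim (0≢0 refl)
lastMinimal-exists (a ∷ f) a∷f≢0 with isZero? f
... | inj₂ f≡0 = v2 a , 0 , lastMinimal-head (head≢0 a∷f≢0 f≡0) (λ j fⱼ≢0 → ⊥-elim (fⱼ≢0 (f≡0 j)))
... | inj₁ f≢0 with lastMinimal-exists f f≢0
...   | μ , i , min-f@(μ≤f , _ , _) with μ ℤP.≤? v2 a | a ℚ.≟ 0ℚ
...     | yes μ≤a | _        = μ , suc i , lastMinimal-∷ (λ _ → μ≤a) min-f
...     | no _    | yes refl = μ , suc i , lastMinimal-∷ (≤v₂-0ℚ μ) min-f
...     | no μ≰a  | no a≢0   = v2 a , 0 , lastMinimal-head a≢0 (≤v₂ₚ-weaken f (ℤP.i<j⇒suc[i]≤j (ℤP.≰⇒> μ≰a)) μ≤f)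

≡v₂-*ₚ-lastMinimal : ∀ {μ ν i j} f g → LastMinimal μ i f → LastMinimal ν j g → μ ℤ.+ ν ≡v₂ coeff (f *ₚ g) (i + j)
≡v₂-*ₚ-lastMinimal [] g (_ , (0≢0 , _) , _) _ = ⊥-elim (0≢0 refl)
≡v₂-*ₚ-lastMinimal {μ} {ν} {zero} {j} (a ∷ f) g (μ≤a∷f , μ≡a , μ<f) (ν≤g , ν≡gⱼ , _) =
  subst (μ ℤ.+ ν ≡v₂_) (sym (coeff-∷*ₚ a f g j)) (≡v₂-+ (≡v₂-* μ≡a ν≡gⱼ) (subst (_≤v₂ coeff (0ℚ ∷ (f *ₚ g)) j) (ℤP.+-assoc (+ 1) μ ν) tail))
  where
  tail : ℤ.suc μ ℤ.+ ν ≤v₂ coeff (0ℚ ∷ (f *ₚ g)) j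
  tail = ≤v₂ₚ-∷ (≤v₂ₚ-*ₚ f g (λ k → μ<f (suc k) (s≤s z≤n)) ν≤g) j
≡v₂-*ₚ-lastMinimal {μ} {ν} {suc i} {j} (a ∷ f) g (μ≤a∷f , μ≡fᵢ , μ<f) min-g@(ν≤g , _ , ν<g) =
  subst (μ ℤ.+ ν ≡v₂_) (sym (trans (coeff-∷*ₚ a f g (suc (i + j))) (ℚP.+-comm (a ℚ.* coeff g (suc (i + j))) (coeff (f *ₚ g) (i + j)))))
        (≡v₂-+ (≡v₂-*ₚ-lastMinimal f g ((μ≤a∷f ∘ suc) , μ≡fᵢ , λ k i<k → μ<f (suc k) (s≤s i<k)) min-g)
               (subst (_≤v₂ a ℚ.* coeff g (suc (i + j))) (ℤ+-CS.x∙yz≈y∙xz μ (+ 1) ν)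
                      (≤v₂-* (μ≤a∷f 0) (ν<g (suc (i + j)) (s≤s (m≤n+m j i))))))

-- Eisenstein's criterion

nonConstant? : ∀ g → Dec (NonConstant g)
nonConstant? []      = no λ { (j , 0≢0) → 0≢0 refl }
nonConstant? (a ∷ g) with isZero? g
... | inj₁ g≢0 = yes g≢0
... | inj₂ g≡0 = no λ { (j , gⱼ≢0) → gⱼ≢0 (g≡0 j) }

nonConstant⇒degree : ∀ {g} → NonConstant g → ∃[ r ] 0 < r × coeff g r ≢ 0ℚ × DegreeAtMost r g
nonConstant⇒degree {g} (j , g₁₊ⱼ≢0) with degree-exists g (suc j , g₁₊ⱼ≢0)
... | zero    , _     , deg-g = ⊥-elim (g₁₊ⱼ≢0 (deg-g (suc j) (s≤s z≤n)))
... | suc r   , gᵣ≢0 , deg-g = suc r , s≤s z≤n , gᵣ≢0 , deg-g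

+1≰+0 : ¬ (+ 1 ℤ.≤ + 0)
+1≰+0 (ℤ.+≤+ ())

+2≰+1 : ¬ (+ 2 ℤ.≤ + 1)
+2≰+1 (ℤ.+≤+ (s≤s ()))

-- Eisenstein's conditions at 2 for the reversed polynomial xⁿ f(1/x).
record ReversedEisenstein (n : ℕ) (f : Poly) : Set where
  field
    degree>0 : 0 < n
    degree≤  : DegreeAtMost n f
    constant : + 0 ≡v₂ coeff f 0
    leading  : + 1 ≡v₂ coeff f n
    higher   : ∀ j → 0 < j → + 1 ≤v₂ coeff f j

module _ {n f} (eis : ReversedEisenstein n f) where
  open ReversedEisenstein eis

  lastMinimal-at-0 : ∀ {g h μ ν i j} → f ≈ₚ (g *ₚ h) → LastMinimal μ i g → LastMinimal ν j h →
                     i + j ≡ 0 × μ ℤ.+ ν ≡ + 0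
  lastMinimal-at-0 {g} {h} {μ} {ν} {i} {j} f≈gh min-g@(μ≤g , _) min-h@(ν≤h , _) = i+j≡0 , μ+ν≡0
    where
    μ+ν≡fᵢ₊ⱼ : μ ℤ.+ ν ≡v₂ coeff f (i + j)
    μ+ν≡fᵢ₊ⱼ = subst (μ ℤ.+ ν ≡v₂_) (sym (f≈gh (i + j))) (≡v₂-*ₚ-lastMinimal g h min-g min-h)
    μ+ν≤0 : μ ℤ.+ ν ℤ.≤ + 0
    μ+ν≤0 = subst (μ ℤ.+ ν ℤ.≤_) (proj₂ constant)
              (subst (μ ℤ.+ ν ≤v₂_) (sym (f≈gh 0)) (≤v₂ₚ-*ₚ g h μ≤g ν≤h 0) (proj₁ constant))
    i+j≡0 : i + j ≡ 0
    i+j≡0 with i + j | μ+ν≡fᵢ₊ⱼ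
    ... | zero  | _ = refl
    ... | suc k | (fₖ≢0 , v2fₖ≡μ+ν) =
      ⊥-elim (+1≰+0 (ℤP.≤-trans (higher (suc k) (s≤s z≤n) fₖ≢0) (subst (ℤ._≤ + 0) (sym v2fₖ≡μ+ν) μ+ν≤0)))
    μ+ν≡0 : μ ℤ.+ ν ≡ + 0
    μ+ν≡0 = trans (sym (proj₂ μ+ν≡fᵢ₊ⱼ)) (trans (cong (λ k → v2 (coeff f k)) i+j≡0) (proj₂ constant))

  product-degree : ∀ {g h r s} → f ≈ₚ (g *ₚ h) → coeff g r ≢ 0ℚ → DegreeAtMost r g →
                   coeff h s ≢ 0ℚ → DegreeAtMost s h → r + s ≡ n
  product-degree {g} {h} {r} {s} f≈gh gᵣ≢0 deg-g hₛ≢0 deg-h with <-cmp (r + s) n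
  ... | tri< r+s<n _ _ = ⊥-elim (proj₁ leading (trans (f≈gh n) (degree-*ₚ g h deg-g deg-h n r+s<n)))
  ... | tri≈ _ r+s≡n _ = r+s≡n
  ... | tri> _ _ r+s>n = ⊥-elim (*-≢0 gᵣ≢0 hₛ≢0 (trans (sym (trans (f≈gh (r + s)) (coeff-*ₚ-top g h deg-g deg-h)))
                                                         (degree≤ (r + s) r+s>n)))

  no-nonconstant-factors : ∀ g h → f ≈ₚ (g *ₚ h) → NonConstant g → NonConstant h → ⊥
  no-nonconstant-factors g h f≈gh g-nc@(jg , g₁₊ⱼ≢0) h-nc@(jh , h₁₊ⱼ≢0)
    with lastMinimal-exists g (suc jg , g₁₊ⱼ≢0) | lastMinimal-exists h (suc jh , h₁₊ⱼ≢0)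
       | nonConstant⇒degree {g} g-nc | nonConstant⇒degree {h} h-nc
  ... | μ , i , min-g@(_ , _ , μ<g) | ν , j , min-h@(_ , _ , ν<h)
      | r , r>0 , gᵣ≢0 , deg-g | s , s>0 , hₛ≢0 , deg-h
    with lastMinimal-at-0 {g} {h} f≈gh min-g min-h
  ... | i+j≡0 , μ+ν≡0 = +2≰+1 (begin
    + 2                              ≡⟨ 2≡1+μ+1+ν ⟩
    ℤ.suc μ ℤ.+ ℤ.suc ν              ≤⟨ ≤v₂-* (μ<g r i<r) (ν<h s j<s) (*-≢0 gᵣ≢0 hₛ≢0) ⟩
    v2 (coeff g r ℚ.* coeff h s)     ≡⟨ cong v2 fₙ≡gᵣhₛ ⟨
    v2 (coeff f n)                   ≡⟨ proj₂ leading ⟩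
    + 1                              ∎)
    where
    open ℤP.≤-Reasoning
    i<r : i < r
    i<r = subst (_< r) (sym (m+n≡0⇒m≡0 i i+j≡0)) r>0
    j<s : j < s
    j<s = subst (_< s) (sym (m+n≡0⇒n≡0 i i+j≡0)) s>0
    2≡1+μ+1+ν : + 2 ≡ ℤ.suc μ ℤ.+ ℤ.suc ν
    2≡1+μ+1+ν = trans (cong (λ k → + 2 ℤ.+ k) (sym μ+ν≡0))
                      (solve 2 (λ μ ν → con (+ 2) :+ (μ :+ ν) := (con (+ 1) :+ μ) :+ (con (+ 1) :+ ν)) refl μ ν)
      where open ℤSolver.+-*-Solver
    fₙ≡gᵣhₛ : coeff f n ≡ coeff g r ℚ.* coeff h s
    fₙ≡gᵣhₛ = subst (λ k → coeff f k ≡ coeff g r ℚ.* coeff h s) (product-degree {g} {h} f≈gh gᵣ≢0 deg-g hₛ≢0 deg-h)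
                (trans (f≈gh (r + s)) (coeff-*ₚ-top g h deg-g deg-h))

  reversedEisenstein⇒irreducible : Irreducible f
  reversedEisenstein⇒irreducible = nonConstant degree>0 (proj₁ leading) , split
    where
    nonConstant : ∀ {m} → 0 < m → coeff f m ≢ 0ℚ → NonConstant f
    nonConstant {suc m} _ fₘ≢0 = m , fₘ≢0
    split : ∀ g h → f ≈ₚ (g *ₚ h) → ¬ NonConstant g ⊎ ¬ NonConstant h
    split g h f≈gh with nonConstant? g | nonConstant? h
    ... | no g-const | _          = inj₁ g-const
    ... | yes _      | no h-const = inj₂ h-const
    ... | yes g-nc   | yes h-nc   = ⊥-elim (no-nonconstant-factors g h f≈gh g-nc h-nc)

  reversedEisenstein⇒Eisenstein2 : Eisenstein2 n f
  reversedEisenstein⇒Eisenstein2 = proj₁ leading , degree≤ , proj₁ constant , above-segment , no-lattice-points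
    where
    above-segment : ∀ j → j ≤ n → coeff f j ≢ 0ℚ →
      + j ℤ.* v2 (coeff f n) ℤ.+ + (n ∸ j) ℤ.* v2 (coeff f 0) ℤ.≤ + n ℤ.* v2 (coeff f j)
    above-segment zero    _   _    = ℤP.≤-reflexive (ℤP.+-identityˡ (+ n ℤ.* v2 (coeff f 0)))
    above-segment (suc j) j<n fⱼ≢0 rewrite proj₂ leading | proj₂ constant = begin
      + suc j ℤ.* + 1 ℤ.+ + (n ∸ suc j) ℤ.* + 0  ≡⟨ cong₂ ℤ._+_ (ℤP.*-identityʳ (+ suc j)) (ℤP.*-zeroʳ (+ (n ∸ suc j))) ⟩
      + suc j ℤ.+ + 0                           ≡⟨ ℤP.+-identityʳ (+ suc j) ⟩
      + suc j                                   ≤⟨ ℤ.+≤+ j<n ⟩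
      + n                                       ≡⟨ ℤP.*-identityʳ (+ n) ⟨
      + n ℤ.* + 1                               ≤⟨ ℤP.*-monoˡ-≤-nonNeg (+ n) (higher (suc j) (s≤s z≤n) fⱼ≢0) ⟩
      + n ℤ.* v2 (coeff f (suc j))              ∎
      where open ℤP.≤-Reasoning
    no-lattice-points : ∀ i → 0 < i → i < n → ¬ (+ n ℤD.∣ + i ℤ.* (v2 (coeff f 0) ℤ.- v2 (coeff f n)))
    no-lattice-points i@(suc _) _ i<n n∣i rewrite proj₂ leading | proj₂ constant =
      <⇒≱ i<n (∣⇒≤ (subst (n ∣_) (trans (ℤP.abs-* (+ i) (ℤ.- + 1)) (*-identityʳ i)) n∣i))

-- The polynomial K

X-_ : ℕ → Poly
X- j = ℚ.- ℕ→ℚ j ∷ 1ℚ ∷ []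

falling-integral : ∀ j → + 0 ≤v₂ₚ falling j
falling-integral zero    zero    = ≡v₂⇒≤v₂ ≡v₂-1ℚ
falling-integral zero    (suc m) = ≤v₂-0ℚ (+ 0)
falling-integral (suc j) = ≤v₂ₚ-*ₚ (falling j) (X- j) (falling-integral j) X-j-integral
  where
  X-j-integral : + 0 ≤v₂ₚ X- j
  X-j-integral zero          = ≤v₂-neg (≤v₂-ℕ→ℚ j)
  X-j-integral (suc zero)    = ≡v₂⇒≤v₂ ≡v₂-1ℚ
  X-j-integral (suc (suc m)) = ≤v₂-0ℚ (+ 0)

degree-X- : ∀ j → DegreeAtMost 1 (X- j)
degree-X- j (suc (suc m)) _ = refl
degree-X- j (suc zero) (s≤s ())

degree-falling : ∀ j → DegreeAtMost j (falling j)
degree-falling zero    (suc m) _ = refl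
degree-falling (suc j) = subst (λ r → DegreeAtMost r (falling (suc j))) (+-comm j 1)
  (degree-*ₚ (falling j) (X- j) (degree-falling j) (degree-X- j))

falling-leading : ∀ j → coeff (falling j) j ≡ 1ℚ
falling-leading zero    = refl
falling-leading (suc j) = begin
  coeff (falling (suc j)) (suc j)         ≡⟨ cong (coeff (falling (suc j))) (+-comm 1 j) ⟩
  coeff (falling j *ₚ X- j) (j + 1)       ≡⟨ coeff-*ₚ-top (falling j) (X- j) (degree-falling j) (degree-X- j) ⟩
  coeff (falling j) j ℚ.* 1ℚ              ≡⟨ cong (ℚ._* 1ℚ) (falling-leading j) ⟩
  1ℚ                                      ∎
  where open ≡-Reasoning

falling-constant : ∀ j → coeff (falling (suc j)) 0 ≡ 0ℚ
falling-constant zero    = refl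
falling-constant (suc j) = trans (coeff-*ₚ-0 (falling (suc j)) (X- suc j))
  (trans (cong (ℚ._* coeff (X- suc j) 0) (falling-constant j)) (ℚP.*-zeroˡ (coeff (X- suc j) 0)))

1≤1+j-v2ℕ[1+j]! : ∀ j → + 1 ℤ.≤ + suc j ℤ.- + v2ℕ (suc j !)
1≤1+j-v2ℕ[1+j]! j = begin
  + 1                              ≤⟨ ℤ.+≤+ (m<n⇒0<n∸m (v2ℕ-n!<n (suc j) (s≤s z≤n))) ⟩
  + (suc j ∸ v2ℕ (suc j !))        ≡⟨ ℤP.≤-⊖ (<⇒≤ (v2ℕ-n!<n (suc j) (s≤s z≤n))) ⟨
  suc j ℤ.⊖ v2ℕ (suc j !)          ≡⟨ ℤP.m-n≡m⊖n (suc j) (v2ℕ (suc j !)) ⟨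
  + suc j ℤ.- + v2ℕ (suc j !)      ∎
  where open ℤP.≤-Reasoning

1/_! : ℕ → ℚ
1/ j ! = ℚ._/_ (+ 1) (j !) {{j !≢0}}

Kscalar : ℕ → ℕ → ℕ → ℚ
Kscalar n t j = ℤ→ℚ ((ℤ.- + 2) ℤ.^ j) ℚ.* ℕ→ℚ ((t ∸ j) C (n ∸ j))

Kterm : ℕ → ℕ → ℕ → Poly
Kterm n t j = scale (Kscalar n t j) (binomPoly j)

-- Kpoly sums its terms with an accumulator local to Defs that cannot be named here;
-- Kpartial n t j is that accumulator (the sum of the terms 0, …, j), obtained as the solution of
-- the unification problem posed by Kpoly-unfold (abstracting suc m makes it a pattern).
mutual
  Kpartial : ℕ → ℕ → ℕ → Poly
  Kpartial = _

  Kpoly-unfold : ∀ m t → Kpoly (suc m) t ≡ Kpartial (suc m) t m +ₚ Kterm (suc m) t (suc m)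
  Kpoly-unfold m t with suc m
  ... | n = refl

module _ (n t : ℕ) where

  coeff-Kterm : ∀ j m → coeff (Kterm n t j) m ≡ Kscalar n t j ℚ.* (1/ j ! ℚ.* coeff (falling j) m)
  coeff-Kterm j m = trans (coeff-scale (Kscalar n t j) (binomPoly j) m) (cong (Kscalar n t j ℚ.*_) (coeff-scale (1/ j !) (falling j) m))

  degree-Kterm : ∀ j → DegreeAtMost j (Kterm n t j)
  degree-Kterm j = degree-scale (Kscalar n t j) (binomPoly j) (degree-scale (1/ j !) (falling j) (degree-falling j))

  Kterm-constant : ∀ j → coeff (Kterm n t (suc j)) 0 ≡ 0ℚ
  Kterm-constant j = begin
    coeff (Kterm n t (suc j)) 0                                   ≡⟨ coeff-Kterm (suc j) 0 ⟩
    Kscalar n t (suc j) ℚ.* (1/ suc j ! ℚ.* coeff (falling (suc j)) 0) ≡⟨ cong (λ c → Kscalar n t (suc j) ℚ.* (1/ suc j ! ℚ.* c)) (falling-constant j) ⟩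
    Kscalar n t (suc j) ℚ.* (1/ suc j ! ℚ.* 0ℚ)                    ≡⟨ cong (Kscalar n t (suc j) ℚ.*_) (ℚP.*-zeroʳ (1/ suc j !)) ⟩
    Kscalar n t (suc j) ℚ.* 0ℚ                                     ≡⟨ ℚP.*-zeroʳ (Kscalar n t (suc j)) ⟩
    0ℚ                                                            ∎
    where open ≡-Reasoning

  ≤v₂-Kterm : ∀ j → + 1 ≤v₂ₚ Kterm n t (suc j)
  ≤v₂-Kterm j = ≤v₂ₚ-weaken (Kterm n t (suc j)) 1≤bound
    (≤v₂ₚ-scale (binomPoly (suc j)) scalar-bound (≤v₂ₚ-scale (falling (suc j)) (≡v₂⇒≤v₂ (≡v₂-1/n! (suc j))) (falling-integral (suc j))))
    where
    v : ℕ
    v = v2ℕ (suc j !)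
    scalar-bound : + suc j ℤ.+ + 0 ≤v₂ Kscalar n t (suc j)
    scalar-bound = ≤v₂-* (≡v₂⇒≤v₂ (≡v₂-[-2]^ (suc j))) (≤v₂-ℕ→ℚ ((t ∸ suc j) C (n ∸ suc j)))
    1≤bound : + 1 ℤ.≤ (+ suc j ℤ.+ + 0) ℤ.+ (ℤ.- + v ℤ.+ + 0)
    1≤bound = subst (+ 1 ℤ.≤_) (cong₂ ℤ._+_ (sym (ℤP.+-identityʳ (+ suc j))) (sym (ℤP.+-identityʳ (ℤ.- + v))))
                    (1≤1+j-v2ℕ[1+j]! j)

  ≡v₂-Kterm-constant : Odd (t C n) → + 0 ≡v₂ coeff (Kterm n t 0) 0
  ≡v₂-Kterm-constant tCn-odd = subst (+ 0 ≡v₂_) (sym (coeff-Kterm 0 0))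
    (≡v₂-* (≡v₂-* (≡v₂-[-2]^ 0) (≡v₂-odd tCn-odd)) (≡v₂-* (≡v₂-1/n! 0) ≡v₂-1ℚ))

  ≡v₂-Kterm-leading : suc (v2ℕ (n !)) ≡ n → + 1 ≡v₂ coeff (Kterm n t n) n
  ≡v₂-Kterm-leading 1+v≡n = subst₂ _≡v₂_ exponent (sym (coeff-Kterm n n))
    (≡v₂-* (≡v₂-* (≡v₂-[-2]^ n) unit-binomial) (≡v₂-* (≡v₂-1/n! n) (subst (+ 0 ≡v₂_) (sym (falling-leading n)) ≡v₂-1ℚ)))
    where
    unit-binomial : + 0 ≡v₂ ℕ→ℚ ((t ∸ n) C (n ∸ n))
    unit-binomial = subst (λ k → + 0 ≡v₂ ℕ→ℚ ((t ∸ n) C k)) (sym (n∸n≡0 n)) (≡v₂-odd 1-odd)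
    exponent : (+ n ℤ.+ + 0) ℤ.+ (ℤ.- + v2ℕ (n !) ℤ.+ + 0) ≡ + 1
    exponent = begin
      (+ n ℤ.+ + 0) ℤ.+ (ℤ.- + v2ℕ (n !) ℤ.+ + 0) ≡⟨ cong₂ ℤ._+_ (ℤP.+-identityʳ (+ n)) (ℤP.+-identityʳ (ℤ.- + v2ℕ (n !))) ⟩
      + n ℤ.- + v2ℕ (n !)                           ≡⟨ cong (λ k → + k ℤ.- + v2ℕ (n !)) (sym 1+v≡n) ⟩
      + suc (v2ℕ (n !)) ℤ.- + v2ℕ (n !)             ≡⟨ +a-+b≡+c-+d (suc (v2ℕ (n !))) (v2ℕ (n !)) 1 0 (+-identityʳ _) ⟩
      + 1                                           ∎
      where open ≡-Reasoning

  degree-Kpartial : ∀ j → DegreeAtMost j (Kpartial n t j)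
  degree-Kpartial zero    = degree-Kterm 0
  degree-Kpartial (suc j) = degree-+ₚ (Kpartial n t j) (Kterm n t (suc j))
    (degree-mono {f = Kpartial n t j} (n≤1+n j) (degree-Kpartial j)) (degree-Kterm (suc j))

  ≤v₂-Kpartial : ∀ j m → 0 < m → + 1 ≤v₂ coeff (Kpartial n t j) m
  ≤v₂-Kpartial zero    m 0<m = subst (+ 1 ≤v₂_) (sym (degree-Kterm 0 m 0<m)) (≤v₂-0ℚ (+ 1))
  ≤v₂-Kpartial (suc j) m 0<m = subst (+ 1 ≤v₂_) (sym (coeff-+ₚ (Kpartial n t j) (Kterm n t (suc j)) m))
    (≤v₂-+ {p = coeff (Kpartial n t j) m} (≤v₂-Kpartial j m 0<m) (≤v₂-Kterm j m))

  Kpartial-constant : ∀ j → coeff (Kpartial n t j) 0 ≡ coeff (Kterm n t 0) 0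
  Kpartial-constant zero    = refl
  Kpartial-constant (suc j) = begin
    coeff (Kpartial n t (suc j)) 0                        ≡⟨ coeff-+ₚ (Kpartial n t j) (Kterm n t (suc j)) 0 ⟩
    coeff (Kpartial n t j) 0 ℚ.+ coeff (Kterm n t (suc j)) 0 ≡⟨ cong₂ ℚ._+_ (Kpartial-constant j) (Kterm-constant j) ⟩
    coeff (Kterm n t 0) 0 ℚ.+ 0ℚ                           ≡⟨ ℚP.+-identityʳ _ ⟩
    coeff (Kterm n t 0) 0                                  ∎
    where open ≡-Reasoning

Kpoly-leading : ∀ m t → coeff (Kpoly (suc m) t) (suc m) ≡ coeff (Kterm (suc m) t (suc m)) (suc m)
Kpoly-leading m t = begin
  coeff (Kpoly (suc m) t) (suc m)                                                    ≡⟨ cong (λ p → coeff p (suc m)) (Kpoly-unfold m t) ⟩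
  coeff (Kpartial (suc m) t m +ₚ Kterm (suc m) t (suc m)) (suc m)                    ≡⟨ coeff-+ₚ (Kpartial (suc m) t m) (Kterm (suc m) t (suc m)) (suc m) ⟩
  coeff (Kpartial (suc m) t m) (suc m) ℚ.+ coeff (Kterm (suc m) t (suc m)) (suc m)   ≡⟨ cong (ℚ._+ coeff (Kterm (suc m) t (suc m)) (suc m)) (degree-Kpartial (suc m) t m (suc m) ≤-refl) ⟩
  0ℚ ℚ.+ coeff (Kterm (suc m) t (suc m)) (suc m)                                     ≡⟨ ℚP.+-identityˡ _ ⟩
  coeff (Kterm (suc m) t (suc m)) (suc m)                                            ∎
  where open ≡-Reasoning

Kpoly-reversedEisenstein : ∀ n t → suc (v2ℕ (n !)) ≡ n → Odd (t C n) → ReversedEisenstein n (Kpoly n t)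
Kpoly-reversedEisenstein n@(suc m) t 1+v≡n tCn-odd = record
  { degree>0 = s≤s z≤n
  ; degree≤  = degree-Kpartial n t n
  ; constant = subst (+ 0 ≡v₂_) (sym (Kpartial-constant n t n)) (≡v₂-Kterm-constant n t tCn-odd)
  ; leading  = subst (+ 1 ≡v₂_) (sym (Kpoly-leading m t)) (≡v₂-Kterm-leading n t 1+v≡n)
  ; higher   = ≤v₂-Kpartial n t n
  }

corollary1p3 : (k t : ℕ) → 2 ^ k ≤ t → t < 2 ^ suc k →
    Eisenstein2 (2 ^ k) (Kpoly (2 ^ k) t) × Irreducible (Kpoly (2 ^ k) t)
corollary1p3 k t 2^k≤t t<2^k+1 = reversedEisenstein⇒Eisenstein2 eis , reversedEisenstein⇒irreducible eis
  where
  eis : ReversedEisenstein (2 ^ k) (Kpoly (2 ^ k) t)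
  eis = Kpoly-reversedEisenstein (2 ^ k) t (suc-v2ℕ-[2^k]! k) (odd-tC2^k k t 2^k≤t t<2^k+1)
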